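{- For every buyback factor $0\le f<\frac13$, every deterministic integral online algorithm for edge-weighted online matching with buyback has competitive ratio at least $\frac{2}{1-f}$; this already holds on instances with two offline nodes.
   Context: Edge-weighted online matching with buyback, deterministic integral setting: offline nodes $V$, each of capacity $1$, known upfront; online nodes arrive one at a time, each revealing nonnegative weights $w_{ij}$ to all $j\in V$. Upon arrival of $i$ a deterministic algorithm either leaves it unmatched or matches it to one offline node $j$, buying back $j$'s current partner $i'$ (if any) entirely, which loses reward $w_{i'j}$ and costs an extra $f\,w_{i'j}$; matching yields reward $w_{ij}$. Profit = reward of final matching minus buyback costs; $\mathrm{OPT}$ = maximum weight bipartite matching; competitive ratio = $\sup_I\mathrm{OPT}(I)/\mathrm{ALG}(I)$.
   Formalization: The buyback factor $f$ ranges over the rationals, and the edge weights of the instances are taken in ℚ. -}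

module Defs where

open import Data.Nat using (ℕ; zero; suc)
open import Data.Integer using (+_)
open import Data.Fin using (Fin; zero; suc)
open import Data.Maybe using (Maybe; just; nothing)
open import Data.List using (List; []; _∷_; _++_; [_]; length; lookup)
open import Data.List.Relation.Unary.All using (All)
open import Data.Product using (_×_; _,_)
open import Relation.Binary.PropositionalEquality using (_≡_)
open import Relation.Nullary.Decidable using (yes; no)
open import Data.Fin using (_≟_)
open import Data.Rational using (ℚ; 0ℚ; 1ℚ; _+_; _-_; _*_; _≤_; _/_)

sumFin : (n : ℕ) → (Fin n → ℚ) → ℚ
sumFin zero    g = 0ℚ
sumFin (suc n) g = g zero + sumFin n (λ j → g (suc j))

-- An online node reveals its weights to the n offline nodes.
Weights : ℕ → Set
Weights n = Fin n → ℚ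

-- An instance: the list of online nodes in arrival order.
Instance : ℕ → Set
Instance n = List (Weights n)

ValidInstance : {n : ℕ} → Instance n → Set
ValidInstance I = All (λ w → ∀ j → 0ℚ ≤ w j) I

-- A deterministic integral online algorithm: given the weight vectors of the
-- previously arrived online nodes (in arrival order) and the weights of the
-- current arrival, it either leaves it unmatched (nothing) or matches it to
-- offline node j (just j), buying back j's current partner if any.
-- (Its own past decisions are a function of the history, so need not be input.)
Algorithm : ℕ → Set
Algorithm n = List (Weights n) → Weights n → Maybe (Fin n)

-- Algorithm state: for each offline node, the weight of its current edge (if matched).
State : ℕ → Set
State n = Fin n → Maybe ℚ

emptyState : {n : ℕ} → State n
emptyState _ = nothing

edgeW : Maybe ℚ → ℚ
edgeW nothing  = 0ℚ
edgeW (just x) = x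

buybackCost : {n : ℕ} → ℚ → State n → Maybe (Fin n) → ℚ
buybackCost f s nothing  = 0ℚ
buybackCost f s (just j) = f * edgeW (s j)

update : {n : ℕ} → State n → Weights n → Maybe (Fin n) → State n
update s w nothing  = s
update s w (just j) k with k ≟ j
... | yes _ = just (w j)
... | no  _ = s k

run : {n : ℕ} → ℚ → Algorithm n → List (Weights n) → State n → ℚ →
      List (Weights n) → State n × ℚ
run f alg past s cost []       = s , cost
run f alg past s cost (w ∷ ws) =
  let d = alg past w in
  run f alg (past ++ [ w ]) (update s w d) (cost + buybackCost f s d) ws

profit : {n : ℕ} → ℚ → Algorithm n → Instance n → ℚ
profit {n} f alg I with run f alg [] emptyState 0ℚ I
... | s , cost = sumFin n (λ j → edgeW (s j)) - cost

-- A (offline) matching of instance I: each offline node gets at most one online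
-- node (an index into I), and no online node is used twice.
record Matching {n : ℕ} (I : Instance n) : Set where
  field
    assign    : Fin n → Maybe (Fin (length I))
    injective : ∀ j k i → assign j ≡ just i → assign k ≡ just i → j ≡ k

matchWeight : {n : ℕ} (I : Instance n) → Matching I → ℚ
matchWeight {n} I M = sumFin n (λ j → val j (Matching.assign M j))
  where
    val : Fin n → Maybe (Fin (length I)) → ℚ
    val j nothing  = 0ℚ
    val j (just i) = lookup I i j

oneThird : ℚ
oneThird = + 1 / 3

two : ℚ
two = + 2 / 1

-- Ignoring the first arrival, which offers 1 to both offline nodes, earns nothing. Otherwise the
-- algorithm has committed to a node p, and the adversary keeps sending arrivals that offer X 1, X 2, …
-- to p only. If the algorithm declines to buy back the newest arrival, the matching that pairs it with
-- p and the first arrival with the other node beats its profit by a ratio c′ > c; buying it back costs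
-- f X k. Choosing the X k to make every refusal exactly c′-bad gives the recurrence
-- X (k+2) = (1 + c′) X (k+1) - c′ (1 + f) X k, which for c′ (1 - f) < 2 and f < 1/3 cannot increase
-- forever; where it first stops increasing, always buying back is worse than c as well.
-- For c < 2 a single further arrival of weight 1 already suffices.

module Submission where

open import Defs
open import Data.Nat as ℕ using (ℕ; zero; suc)
import Data.Nat.Properties as ℕ
open import Data.Fin as Fin using (Fin; zero; suc)
open import Data.Maybe using (Maybe; just; nothing)
import Data.Maybe.Properties as Maybe
open import Data.List using (List; []; _∷_; _++_; [_]; length; lookup)
open import Data.List.Properties using (++-identityʳ; ++-assoc)
open import Data.List.Relation.Unary.All using ([]; _∷_)
import Data.List.Relation.Unary.All.Properties as All
open import Data.Product using (∃; Σ; _×_; _,_; proj₁; proj₂)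
open import Data.Sum using (_⊎_; inj₁; inj₂)
open import Data.Empty using (⊥-elim)
open import Function using (_∘_)
open import Relation.Binary.PropositionalEquality hiding ([_])
open import Relation.Nullary using (yes; no)
import Data.Integer as ℤ
import Data.Integer.Properties as ℤ
open import Data.Rational
  using (ℚ; 0ℚ; 1ℚ; _+_; _-_; -_; _*_; _≤_; _<_; _/_; *≤*; 1/_; mkℚ; ↥_;
         Positive; NonNegative; NonZero; positive; nonNegative)
import Data.Rational.Unnormalised as ℚᵘ
import Data.Rational.Unnormalised.Properties as ℚᵘ
open import Data.Rational.Properties
open import Data.Rational.Literals using (fromℤ)
open import Data.Rational.Solver using (module +-*-Solver)
open +-*-Solver

p≤q⇒0≤q-p : ∀ {p q} → p ≤ q → 0ℚ ≤ q - p
p≤q⇒0≤q-p {p} p≤q = ≤-trans (≤-reflexive (sym (+-inverseʳ p))) (+-monoˡ-≤ (- p) p≤q)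

p<q⇒0<q-p : ∀ {p q} → p < q → 0ℚ < q - p
p<q⇒0<q-p {p} p<q = ≤-<-trans (≤-reflexive (sym (+-inverseʳ p))) (+-monoˡ-< (- p) p<q)

p+[q-p]≡q : ∀ p q → p + (q - p) ≡ q
p+[q-p]≡q = solve 2 (λ p q → p :+ (q :- p) := q) refl

≤-byDifference : ∀ {p q} r → q - p ≡ r → 0ℚ ≤ r → p ≤ q
≤-byDifference {p} {q} r q-p≡r 0≤r = begin
  p            ≡⟨ sym (+-identityʳ p) ⟩
  p + 0ℚ       ≤⟨ +-monoʳ-≤ p (subst (0ℚ ≤_) (sym q-p≡r) 0≤r) ⟩
  p + (q - p)  ≡⟨ p+[q-p]≡q p q ⟩
  q            ∎
  where open ≤-Reasoning

<-byDifference : ∀ {p q} r → q - p ≡ r → 0ℚ < r → p < q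
<-byDifference {p} {q} r q-p≡r 0<r = begin-strict
  p            ≡⟨ sym (+-identityʳ p) ⟩
  p + 0ℚ       <⟨ +-monoʳ-< p (subst (0ℚ <_) (sym q-p≡r) 0<r) ⟩
  p + (q - p)  ≡⟨ p+[q-p]≡q p q ⟩
  q            ∎
  where open ≤-Reasoning

*-nonNeg : ∀ {p q} → 0ℚ ≤ p → 0ℚ ≤ q → 0ℚ ≤ p * q
*-nonNeg {p} {q} 0≤p 0≤q =
  nonNegative⁻¹ _ {{nonNeg*nonNeg⇒nonNeg p {{nonNegative 0≤p}} q {{nonNegative 0≤q}}}}

*-pos : ∀ {p q} → 0ℚ < p → 0ℚ < q → 0ℚ < p * q
*-pos {p} {q} 0<p 0<q = positive⁻¹ _ {{pos*pos⇒pos p {{positive 0<p}} q {{positive 0<q}}}}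

0<1 : 0ℚ < 1ℚ
0<1 = positive⁻¹ 1ℚ

fromℕ : ℕ → ℚ
fromℕ zero    = 0ℚ
fromℕ (suc n) = fromℕ n + 1ℚ

fromℕ-nonNeg : ∀ n → 0ℚ ≤ fromℕ n
fromℕ-nonNeg zero    = ≤-refl
fromℕ-nonNeg (suc n) = +-mono-≤ (fromℕ-nonNeg n) (<⇒≤ 0<1)

fromℕ≡fromℤ : ∀ n → fromℕ n ≡ fromℤ (ℤ.+ n)
fromℕ≡fromℤ zero    = refl
fromℕ≡fromℤ (suc n) rewrite fromℕ≡fromℤ n =
  toℚᵘ-injective (ℚᵘ.≃-trans (toℚᵘ-homo-+ (fromℤ (ℤ.+ n)) 1ℚ) (ℚᵘ.*≡* cross))
  where
  cross : (ℤ.+ n ℤ.* ℤ.+ 1 ℤ.+ ℤ.+ 1 ℤ.* ℤ.+ 1) ℤ.* ℤ.+ 1 ≡ (ℤ.+ 1 ℤ.+ ℤ.+ n) ℤ.* ℤ.+ (1 ℕ.* 1)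
  cross = trans (ℤ.*-identityʳ _) (trans (cong (ℤ._+ ℤ.+ 1) (ℤ.*-identityʳ (ℤ.+ n)))
            (trans (ℤ.+-comm (ℤ.+ n) (ℤ.+ 1)) (sym (ℤ.*-identityʳ (ℤ.+ 1 ℤ.+ ℤ.+ n)))))

i≤+∣i∣ : ∀ i → i ℤ.≤ ℤ.+ ℤ.∣ i ∣
i≤+∣i∣ (ℤ.+ n)     = ℤ.≤-refl
i≤+∣i∣ ℤ.-[1+ n ] = ℤ.-≤+

≤-fromℕ∣↥∣ : ∀ q → q ≤ fromℕ ℤ.∣ ↥ q ∣
≤-fromℕ∣↥∣ q@(mkℚ num d _) = subst (q ≤_) (sym (fromℕ≡fromℤ ℤ.∣ num ∣)) (*≤* num≤)
  where
  num≤ : num ℤ.* ℤ.+ 1 ℤ.≤ ℤ.+ ℤ.∣ num ∣ ℤ.* ℤ.+ suc d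
  num≤ = ℤ.≤-trans (ℤ.≤-reflexive (ℤ.*-identityʳ num))
           (ℤ.≤-trans (i≤+∣i∣ num) (ℤ.≤-trans (ℤ.+≤+ (ℕ.m≤m*n ℤ.∣ num ∣ (suc d)))
             (ℤ.≤-reflexive (ℤ.pos-* ℤ.∣ num ∣ (suc d)))))

archimedean : ∀ a b → 0ℚ < a → ∃ λ n → b ≤ fromℕ n * a
archimedean a b 0<a = ℤ.∣ ↥ (b * (1/ a)) ∣ , (begin
  b              ≡⟨ sym (trans (*-assoc b (1/ a) a) (trans (cong (b *_) (*-inverseˡ a)) (*-identityʳ b))) ⟩
  b * (1/ a) * a ≤⟨ *-monoʳ-≤-nonNeg a (≤-fromℕ∣↥∣ (b * (1/ a))) ⟩
  _              ∎)
  where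
  open ≤-Reasoning
  instance
    _ : Positive a
    _ = positive 0<a
    _ : NonZero a
    _ = pos⇒nonZero a
    _ : NonNegative a
    _ = nonNegative (<⇒≤ 0<a)

infixr 8 _^_
_^_ : ℚ → ℕ → ℚ
a ^ zero  = 1ℚ
a ^ suc n = a * a ^ n

^-nonNeg : ∀ {a} n → 0ℚ ≤ a → 0ℚ ≤ a ^ n
^-nonNeg zero    0≤a = <⇒≤ 0<1
^-nonNeg (suc n) 0≤a = *-nonNeg 0≤a (^-nonNeg n 0≤a)

^-bernoulli : ∀ {a b} n → 0ℚ ≤ a → a ≤ b → a ^ n * (a + fromℕ (suc n) * (b - a)) ≤ b ^ suc n
^-bernoulli {a} {b} zero 0≤a a≤b = ≤-reflexive
  (solve 2 (λ a b → con 1ℚ :* (a :+ (con 0ℚ :+ con 1ℚ) :* (b :- a)) := b :* con 1ℚ) refl a b)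
^-bernoulli {a} {b} (suc n) 0≤a a≤b =
  ≤-byDifference (b * (b ^ suc n - a ^ n * (a + i * δ)) + a ^ n * i * (δ * δ))
    (solve 5 (λ a b S T i → b :* S :- (a :* T) :* (a :+ (i :+ con 1ℚ) :* (b :- a))
                           := b :* (S :- T :* (a :+ i :* (b :- a))) :+ T :* i :* ((b :- a) :* (b :- a)))
       refl a b (b ^ suc n) (a ^ n) i)
    (+-mono-≤ (*-nonNeg (≤-trans 0≤a a≤b) (p≤q⇒0≤q-p (^-bernoulli n 0≤a a≤b)))
              (*-nonNeg (*-nonNeg (^-nonNeg n 0≤a) (fromℕ-nonNeg (suc n))) (*-nonNeg 0≤δ 0≤δ)))
  where
  i δ : ℚ
  i = fromℕ (suc n)
  δ = b - a
  0≤δ : 0ℚ ≤ δ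
  0≤δ = p≤q⇒0≤q-p a≤b

^-dominates : ∀ K ε {a b} → 0ℚ < ε → 0ℚ ≤ a → a < b → ∃ λ k → K * a ^ k ≤ ε * b ^ k
^-dominates K ε {a} {b} 0<ε 0≤a a<b =
  let n , bound = archimedean (ε * δ) ((K - ε) * a) 0<εδ in suc n , dominates n bound
  where
  δ : ℚ
  δ = b - a
  0<εδ : 0ℚ < ε * δ
  0<εδ = *-pos 0<ε (p<q⇒0<q-p a<b)
  dominates : ∀ n → (K - ε) * a ≤ fromℕ n * (ε * δ) → K * a ^ suc n ≤ ε * b ^ suc n
  dominates n bound =
    ≤-byDifference (ε * (b ^ suc n - a ^ n * (a + i * δ)) + a ^ n * (i * (ε * δ) - (K - ε) * a))
      (solve 7 (λ K e S T a i d → e :* S :- K :* (a :* T)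
                                 := e :* (S :- T :* (a :+ i :* d)) :+ T :* (i :* (e :* d) :- (K :- e) :* a))
         refl K ε (b ^ suc n) (a ^ n) a i δ)
      (+-mono-≤ (*-nonNeg (<⇒≤ 0<ε) (p≤q⇒0≤q-p (^-bernoulli n 0≤a (<⇒≤ a<b))))
                (*-nonNeg (^-nonNeg n 0≤a) (p≤q⇒0≤q-p bound′)))
    where
    i : ℚ
    i = fromℕ (suc n)
    bound′ : (K - ε) * a ≤ i * (ε * δ)
    bound′ = ≤-trans bound (≤-byDifference (ε * δ)
      (solve 2 (λ n x → (n :+ con 1ℚ) :* x :- n :* x := x) refl (fromℕ n) (ε * δ)) (<⇒≤ 0<εδ))

other : Fin 2 → Fin 2
other zero       = suc zero
other (suc zero) = zero

other≢ : ∀ p → other p ≢ p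
other≢ zero       ()
other≢ (suc zero) ()

≢⇒≡other : ∀ p q → q ≢ p → q ≡ other p
≢⇒≡other zero       zero       q≢p = ⊥-elim (q≢p refl)
≢⇒≡other zero       (suc zero) q≢p = refl
≢⇒≡other (suc zero) zero       q≢p = refl
≢⇒≡other (suc zero) (suc zero) q≢p = ⊥-elim (q≢p refl)

sumFin-2 : ∀ p g → sumFin 2 g ≡ g p + g (other p)
sumFin-2 zero       g = cong (g zero +_) (+-identityʳ (g (suc zero)))
sumFin-2 (suc zero) g = trans (cong (g zero +_) (+-identityʳ (g (suc zero)))) (+-comm (g zero) (g (suc zero)))

atOr : {A : Set} → Fin 2 → A → A → Fin 2 → A
atOr zero       a b zero       = a
atOr zero       a b (suc zero) = b
atOr (suc zero) a b zero       = b
atOr (suc zero) a b (suc zero) = a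

atOr-at : {A : Set} (p : Fin 2) (a b : A) → atOr p a b p ≡ a
atOr-at zero       a b = refl
atOr-at (suc zero) a b = refl

atOr-other : {A : Set} (p : Fin 2) (a b : A) → atOr p a b (other p) ≡ b
atOr-other zero       a b = refl
atOr-other (suc zero) a b = refl

atOr-nonNeg : ∀ p {a b} → 0ℚ ≤ a → 0ℚ ≤ b → ∀ j → 0ℚ ≤ atOr p a b j
atOr-nonNeg zero       0≤a 0≤b zero       = 0≤a
atOr-nonNeg zero       0≤a 0≤b (suc zero) = 0≤b
atOr-nonNeg (suc zero) 0≤a 0≤b zero       = 0≤b
atOr-nonNeg (suc zero) 0≤a 0≤b (suc zero) = 0≤a

atOr-injective : {A : Set} (p : Fin 2) {a b : A} → a ≢ b → ∀ j k → atOr p a b j ≡ atOr p a b k → j ≡ k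
atOr-injective zero       a≢b zero       zero       eq = refl
atOr-injective zero       a≢b zero       (suc zero) eq = ⊥-elim (a≢b eq)
atOr-injective zero       a≢b (suc zero) zero       eq = ⊥-elim (a≢b (sym eq))
atOr-injective zero       a≢b (suc zero) (suc zero) eq = refl
atOr-injective (suc zero) a≢b zero       zero       eq = refl
atOr-injective (suc zero) a≢b zero       (suc zero) eq = ⊥-elim (a≢b (sym eq))
atOr-injective (suc zero) a≢b (suc zero) zero       eq = ⊥-elim (a≢b eq)
atOr-injective (suc zero) a≢b (suc zero) (suc zero) eq = refl

update-at : ∀ {n} (s : State n) w j → update s w (just j) j ≡ just (w j)
update-at s w j with j Fin.≟ j
... | yes _   = refl
... | no  j≢j = ⊥-elim (j≢j refl)

update-elsewhere : ∀ {n} (s : State n) w {j k} → k ≢ j → update s w (just j) k ≡ s k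
update-elsewhere s w {j} {k} k≢j with k Fin.≟ j
... | yes k≡j = ⊥-elim (k≢j k≡j)
... | no  _   = refl

step : ∀ {n} → ℚ → Algorithm n → List (Weights n) → Weights n → State n × ℚ → State n × ℚ
step f alg past w (s , cost) = update s w (alg past w) , cost + buybackCost f s (alg past w)

run-∷ʳ : ∀ {n} f alg (past : List (Weights n)) s cost ws w →
  run f alg past s cost (ws ++ [ w ]) ≡ step f alg (past ++ ws) w (run f alg past s cost ws)
run-∷ʳ f alg past s cost [] w rewrite ++-identityʳ past = refl
run-∷ʳ f alg past s cost (w′ ∷ ws) w
  rewrite run-∷ʳ f alg (past ++ [ w′ ]) (update s w′ (alg past w′)) (cost + buybackCost f s (alg past w′)) ws w
        | ++-assoc past [ w′ ] ws = refl

lookup-last : {A : Set} (xs : List A) (x : A) → Σ (Fin (length (xs ++ [ x ]))) λ i → lookup (xs ++ [ x ]) i ≡ x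
lookup-last []       x = zero , refl
lookup-last (y ∷ ys) x = let i , eq = lookup-last ys x in suc i , eq

BeatsRatio : ℚ → Algorithm 2 → ℚ → Set
BeatsRatio f alg c = ∃ λ (I : Instance 2) → ValidInstance I × ∃ λ (M : Matching I) → c * profit f alg I < matchWeight I M

buybackTotal : ℚ → (ℕ → ℚ) → ℕ → ℚ
buybackTotal f X zero    = 0ℚ
buybackTotal f X (suc k) = buybackTotal f X k + f * X k

module Adversary (f : ℚ) (alg : Algorithm 2) (X : ℕ → ℚ) where

  first : Weights 2
  first _ = X 0

  chase : Fin 2 → ℕ → Weights 2
  chase p k = atOr p (X k) 0ℚ

  chases : Fin 2 → ℕ → List (Weights 2)
  chases p zero    = []
  chases p (suc k) = chases p k ++ [ chase p (suc k) ]

  arrivals : Fin 2 → ℕ → Instance 2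
  arrivals p k = first ∷ chases p k

  outcome : Fin 2 → ℕ → State 2 × ℚ
  outcome p k = run f alg [] emptyState 0ℚ (arrivals p k)

  decision : Fin 2 → ℕ → Maybe (Fin 2)
  decision p zero    = alg [] first
  decision p (suc k) = alg (arrivals p k) (chase p (suc k))

  outcome-suc : ∀ p k → outcome p (suc k) ≡ step f alg (arrivals p k) (chase p (suc k)) (outcome p k)
  outcome-suc p k = run-∷ʳ f alg [] emptyState 0ℚ (arrivals p k) (chase p (suc k))

  FollowsUpTo : Fin 2 → ℕ → Set
  FollowsUpTo p n = ∀ j → j ℕ.≤ n → decision p j ≡ just p

  followsUpTo-suc : ∀ p n → FollowsUpTo p n → decision p (suc n) ≡ just p → FollowsUpTo p (suc n)
  followsUpTo-suc p n follows next j j≤1+n with ℕ.m≤n⇒m<n∨m≡n j≤1+n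
  ... | inj₁ j<1+n = follows j (ℕ.≤-pred j<1+n)
  ... | inj₂ refl  = next

  follows-or-deviates : ∀ p n → FollowsUpTo p 0 →
    FollowsUpTo p n ⊎ Σ ℕ λ m → m ℕ.< n × FollowsUpTo p m × decision p (suc m) ≢ just p
  follows-or-deviates p zero    follows₀ = inj₁ follows₀
  follows-or-deviates p (suc n) follows₀ with follows-or-deviates p n follows₀
  ... | inj₂ (m , m<n , follows , deviates) = inj₂ (m , ℕ.m<n⇒m<1+n m<n , follows , deviates)
  ... | inj₁ follows with Maybe.≡-dec Fin._≟_ (decision p (suc n)) (just p)
  ...   | yes next     = inj₁ (followsUpTo-suc p n follows next)
  ...   | no  deviates = inj₂ (n , ℕ.n<1+n n , follows , deviates)

  FollowedState : Fin 2 → ℕ → Set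
  FollowedState p n = proj₁ (outcome p n) p ≡ just (X n)
                    × proj₁ (outcome p n) (other p) ≡ nothing
                    × proj₂ (outcome p n) ≡ buybackTotal f X n

  followedState : ∀ p n → FollowsUpTo p n → FollowedState p n
  followedState p zero follows with alg [] first | follows 0 ℕ.z≤n
  ... | .(just p) | refl =
    update-at emptyState first p ,
    update-elsewhere emptyState first (other≢ p) ,
    trans (cong (0ℚ +_) (*-zeroʳ f)) (+-identityʳ 0ℚ)
  followedState p (suc n) follows rewrite outcome-suc p n
    with outcome p n | followedState p n (λ j j≤n → follows j (ℕ.m≤n⇒m≤1+n j≤n)) | follows (suc n) ℕ.≤-refl
  ... | s , cost | atP , atOther , paid | next rewrite next | paid =
    trans (update-at s (chase p (suc n)) p) (cong just (atOr-at p _ _)) ,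
    trans (update-elsewhere s (chase p (suc n)) (other≢ p)) atOther ,
    cong (λ e → buybackTotal f X n + f * edgeW e) atP

  profit-arrivals : ∀ p n →
    profit f alg (arrivals p n) ≡ sumFin 2 (λ j → edgeW (proj₁ (outcome p n) j)) - proj₂ (outcome p n)
  profit-arrivals p n = refl

  profit-follows : ∀ p n → FollowsUpTo p n → profit f alg (arrivals p n) ≡ X n - buybackTotal f X n
  profit-follows p n follows with outcome p n | followedState p n follows
  ... | s , cost | atP , atOther , paid =
    trans (cong (_- cost) (sumFin-2 p (λ j → edgeW (s j)))) final
    where
    final : edgeW (s p) + edgeW (s (other p)) - cost ≡ X n - buybackTotal f X n
    final rewrite atP | atOther | paid = cong (_- buybackTotal f X n) (+-identityʳ (X n))

  -- Deviating means leaving the arrival unmatched or putting it on the other node, where it weighs 0.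
  profit-deviates : ∀ p m → FollowsUpTo p m → decision p (suc m) ≢ just p →
    profit f alg (arrivals p (suc m)) ≡ X m - buybackTotal f X m
  profit-deviates p m follows deviates rewrite profit-arrivals p (suc m) | outcome-suc p m
    with outcome p m | followedState p m follows
  ... | s , cost | atP , atOther , paid with alg (arrivals p m) (chase p (suc m))
  ... | nothing rewrite sumFin-2 p (λ j → edgeW (s j)) | atP | atOther | paid =
    cong₂ _-_ (+-identityʳ (X m)) (+-identityʳ (buybackTotal f X m))
  ... | just q with ≢⇒≡other p q (deviates ∘ cong just)
  ... | refl rewrite sumFin-2 p (λ j → edgeW (update s (chase p (suc m)) (just (other p)) j))
                   | update-at s (chase p (suc m)) (other p)
                   | update-elsewhere s (chase p (suc m)) {other p} {p} (other≢ p ∘ sym)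
                   | atOr-other p (X (suc m)) 0ℚ | atP | atOther | paid =
    cong₂ _-_ (+-identityʳ (X m))
              (trans (cong (buybackTotal f X m +_) (*-zeroʳ f)) (+-identityʳ (buybackTotal f X m)))

  profit-first-unmatched : alg [] first ≡ nothing → profit f alg (arrivals zero 0) ≡ 0ℚ
  profit-first-unmatched unmatched rewrite profit-arrivals zero 0 | unmatched = refl

  firstMatching : Matching (arrivals zero 0)
  firstMatching = record { assign = assign ; injective = injective }
    where
    assign : Fin 2 → Maybe (Fin 1)
    assign zero       = just zero
    assign (suc zero) = nothing
    injective : ∀ j k i → assign j ≡ just i → assign k ≡ just i → j ≡ k
    injective zero       zero       i _ _  = refl
    injective zero       (suc zero) i _ ()
    injective (suc zero) k          i () _

  firstMatching-weight : matchWeight (arrivals zero 0) firstMatching ≡ X 0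
  firstMatching-weight = +-identityʳ (X 0)

  chaseMatching : ∀ p m → Fin (length (chases p (suc m))) → Matching (arrivals p (suc m))
  chaseMatching p m i = record
    { assign    = atOr p (just (suc i)) (just zero)
    ; injective = λ j k i′ eq₁ eq₂ → atOr-injective p (λ ()) j k (trans eq₁ (sym eq₂))
    }

  chaseMatching-weight : ∀ p m i → lookup (chases p (suc m)) i ≡ chase p (suc m) →
    matchWeight (arrivals p (suc m)) (chaseMatching p m i) ≡ X (suc m) + X 0
  chaseMatching-weight zero       m i last =
    cong₂ _+_ (cong (λ w → w zero) last) (+-identityʳ (X 0))
  chaseMatching-weight (suc zero) m i last =
    trans (cong (X 0 +_) (trans (+-identityʳ _) (cong (λ w → w (suc zero)) last))) (+-comm (X 0) (X (suc m)))

  arrivals-valid : ∀ p n → (∀ k → k ℕ.≤ n → 0ℚ ≤ X k) → ValidInstance (arrivals p n)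
  arrivals-valid p n nonNeg = (λ _ → nonNeg 0 ℕ.z≤n) ∷ chases-valid n nonNeg
    where
    chases-valid : ∀ n → (∀ k → k ℕ.≤ n → 0ℚ ≤ X k) → ValidInstance (chases p n)
    chases-valid zero    nonNeg = []
    chases-valid (suc n) nonNeg =
      All.++⁺ (chases-valid n (λ k k≤n → nonNeg k (ℕ.m≤n⇒m≤1+n k≤n)))
              (atOr-nonNeg p (nonNeg (suc n) ℕ.≤-refl) ≤-refl ∷ [])

  beatsRatio : ∀ c → 0ℚ < X 0 → ∀ M → (∀ k → k ℕ.≤ suc M → 0ℚ ≤ X k) →
    (∀ k → k ℕ.< suc M → c * (X k - buybackTotal f X k) < X (suc k) + X 0) →
    c * (X (suc M) - buybackTotal f X (suc M)) < X (suc M) + X 0 →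
    BeatsRatio f alg c
  beatsRatio c 0<X₀ M nonNeg deviation-loses following-loses with alg [] first in first-decision
  ... | nothing =
    arrivals zero 0 , arrivals-valid zero 0 (λ k k≤0 → nonNeg k (ℕ.≤-trans k≤0 ℕ.z≤n)) , firstMatching ,
    subst₂ _<_ (sym (trans (cong (c *_) (profit-first-unmatched first-decision)) (*-zeroʳ c)))
               (sym firstMatching-weight) 0<X₀
  ... | just p with follows-or-deviates p (suc M) (λ { zero _ → first-decision })
  ... | inj₁ follows =
    let i , last = lookup-last (chases p M) (chase p (suc M)) in
    arrivals p (suc M) , arrivals-valid p (suc M) nonNeg , chaseMatching p M i ,
    subst₂ _<_ (sym (cong (c *_) (profit-follows p (suc M) follows)))
               (sym (chaseMatching-weight p M i last)) following-loses
  ... | inj₂ (m , m<1+M , follows , deviates) =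
    let i , last = lookup-last (chases p m) (chase p (suc m)) in
    arrivals p (suc m) , arrivals-valid p (suc m) (λ k k≤1+m → nonNeg k (ℕ.≤-trans k≤1+m m<1+M)) ,
    chaseMatching p m i ,
    subst₂ _<_ (sym (cong (c *_) (profit-deviates p m follows deviates)))
               (sym (chaseMatching-weight p m i last)) (deviation-loses m m<1+M)

Increasing : (ℕ → ℚ) → ℕ → Set
Increasing X n = ∀ j → j ℕ.< n → X j < X (suc j)

increasing-or-drop : ∀ X n → (∃ λ N → Increasing X N × X (suc N) ≤ X N) ⊎ Increasing X n
increasing-or-drop X zero = inj₂ (λ j ())
increasing-or-drop X (suc n) with increasing-or-drop X n
... | inj₁ drop = inj₁ drop
... | inj₂ increasing with X n <? X (suc n)
...   | yes up = inj₂ extended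
  where
  extended : Increasing X (suc n)
  extended j j<1+n with ℕ.m≤n⇒m<n∨m≡n (ℕ.≤-pred j<1+n)
  ... | inj₁ j<n  = increasing j j<n
  ... | inj₂ refl = up
...   | no ¬up = inj₁ (n , increasing , ≮⇒≥ ¬up)

-- The gap P k = X (k+1) - t₁ X k satisfies P (k+1) ≤ t₂ P k as long as X stays nonnegative, so
-- P k ≤ -ε t₂^k while X k ≤ X 0 t₁^k; as t₂ > t₁ the gap eventually outweighs the growth (t₁ - 1) X k.
module Growth (X : ℕ → ℚ) (q t₁ t₂ : ℚ)
  (recurrence : ∀ k → X (suc (suc k)) ≡ (t₁ + t₂) * X (suc k) - q * X k)
  (t₁t₂≤q : t₁ * t₂ ≤ q) (1≤t₁ : 1ℚ ≤ t₁) (t₁<t₂ : t₁ < t₂)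
  (0≤X₀ : 0ℚ ≤ X 0) (X₁<t₁X₀ : X 1 < t₁ * X 0) where

  ε : ℚ
  ε = t₁ * X 0 - X 1

  0≤t₁ : 0ℚ ≤ t₁
  0≤t₁ = ≤-trans (<⇒≤ 0<1) 1≤t₁

  0≤t₂ : 0ℚ ≤ t₂
  0≤t₂ = ≤-trans 0≤t₁ (<⇒≤ t₁<t₂)

  increasing⇒nonNeg : ∀ {n} → Increasing X n → ∀ j → j ℕ.≤ n → 0ℚ ≤ X j
  increasing⇒nonNeg increasing zero    _      = 0≤X₀
  increasing⇒nonNeg increasing (suc j) 1+j≤n =
    ≤-trans (increasing⇒nonNeg increasing j (ℕ.≤-trans (ℕ.n≤1+n j) 1+j≤n)) (<⇒≤ (increasing j 1+j≤n))

  P : ℕ → ℚ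
  P k = X (suc k) - t₁ * X k

  P-suc : ∀ k → P (suc k) ≡ t₂ * P k + (t₁ * t₂ - q) * X k
  P-suc k = begin
    X (suc (suc k)) - t₁ * X (suc k)
      ≡⟨ cong (_- t₁ * X (suc k)) (recurrence k) ⟩
    ((t₁ + t₂) * X (suc k) - q * X k) - t₁ * X (suc k)
      ≡⟨ solve 5 (λ a b q x x′ → ((a :+ b) :* x′ :- q :* x) :- a :* x′ := b :* (x′ :- a :* x) :+ (a :* b :- q) :* x)
           refl t₁ t₂ q (X k) (X (suc k)) ⟩
    t₂ * P k + (t₁ * t₂ - q) * X k
      ∎
    where open ≡-Reasoning

  0<ε : 0ℚ < ε
  0<ε = p<q⇒0<q-p X₁<t₁X₀

  P-bound : ∀ {k} → Increasing X (suc k) → ∀ j → j ℕ.≤ k → P j ≤ - (ε * t₂ ^ j)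
  P-bound increasing zero _ = ≤-reflexive
    (solve 3 (λ x₀ x₁ a → x₁ :- a :* x₀ := :- ((a :* x₀ :- x₁) :* con 1ℚ)) refl (X 0) (X 1) t₁)
  P-bound increasing (suc j) 1+j≤k = ≤-byDifference
    (t₂ * (- (ε * t₂ ^ j) - P j) + (q - t₁ * t₂) * X j)
    (trans (cong (λ x → - (ε * t₂ ^ suc j) - x) (P-suc j))
      (solve 7 (λ b T m q x e p → :- (e :* (b :* T)) :- (b :* p :+ (m :- q) :* x)
                                 := b :* (:- (e :* T) :- p) :+ (q :- m) :* x)
         refl t₂ (t₂ ^ j) (t₁ * t₂) q (X j) ε (P j)))
    (+-mono-≤ (*-nonNeg 0≤t₂ (p≤q⇒0≤q-p (P-bound increasing j j≤k)))
              (*-nonNeg (p≤q⇒0≤q-p t₁t₂≤q) (increasing⇒nonNeg increasing j (ℕ.m≤n⇒m≤1+n j≤k))))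
    where
    j≤k : j ℕ.≤ _
    j≤k = ℕ.≤-trans (ℕ.n≤1+n j) 1+j≤k

  P-nonPos : ∀ {k} → Increasing X (suc k) → ∀ j → j ℕ.≤ k → P j ≤ 0ℚ
  P-nonPos increasing j j≤k =
    ≤-trans (P-bound increasing j j≤k) (neg-antimono-≤ (*-nonNeg (<⇒≤ 0<ε) (^-nonNeg j 0≤t₂)))

  X-bound : ∀ {k} → Increasing X (suc k) → ∀ j → j ℕ.≤ suc k → X j ≤ X 0 * t₁ ^ j
  X-bound increasing zero    _       = ≤-reflexive (sym (*-identityʳ (X 0)))
  X-bound increasing (suc j) 1+j≤1+k = ≤-byDifference
    (t₁ * (X 0 * t₁ ^ j - X j) + (0ℚ - P j))
    (solve 5 (λ x₀ a T x x′ → x₀ :* (a :* T) :- x′ := a :* (x₀ :* T :- x) :+ (con 0ℚ :- (x′ :- a :* x)))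
       refl (X 0) t₁ (t₁ ^ j) (X j) (X (suc j)))
    (+-mono-≤ (*-nonNeg 0≤t₁ (p≤q⇒0≤q-p (X-bound increasing j (ℕ.≤-trans (ℕ.n≤1+n j) 1+j≤1+k))))
              (p≤q⇒0≤q-p (P-nonPos increasing j (ℕ.≤-pred 1+j≤1+k))))

  stops-increasing : ∀ k → (t₁ - 1ℚ) * X 0 * t₁ ^ k ≤ ε * t₂ ^ k → Increasing X (suc k) → X (suc k) ≤ X k
  stops-increasing k dominated increasing = ≤-byDifference
    ((ε * t₂ ^ k - (t₁ - 1ℚ) * X 0 * t₁ ^ k) + (t₁ - 1ℚ) * (X 0 * t₁ ^ k - X k) + (- (ε * t₂ ^ k) - P k))
    (solve 7 (λ a x₀ T₁ e T₂ x x′ →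
                x :- x′ := (e :* T₂ :- (a :- con 1ℚ) :* x₀ :* T₁) :+ (a :- con 1ℚ) :* (x₀ :* T₁ :- x)
                           :+ (:- (e :* T₂) :- (x′ :- a :* x)))
       refl t₁ (X 0) (t₁ ^ k) ε (t₂ ^ k) (X k) (X (suc k)))
    (+-mono-≤ (+-mono-≤ (p≤q⇒0≤q-p dominated)
                        (*-nonNeg (p≤q⇒0≤q-p 1≤t₁) (p≤q⇒0≤q-p (X-bound increasing k (ℕ.n≤1+n k)))))
              (p≤q⇒0≤q-p (P-bound increasing k ℕ.≤-refl)))

  eventually-drops : ∃ λ N → Increasing X N × X (suc N) ≤ X N
  eventually-drops = drops (^-dominates ((t₁ - 1ℚ) * X 0) ε 0<ε 0≤t₁ t₁<t₂)
    where
    drops : (∃ λ k → (t₁ - 1ℚ) * X 0 * t₁ ^ k ≤ ε * t₂ ^ k) → ∃ λ N → Increasing X N × X (suc N) ≤ X N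
    drops (k , dominated) with increasing-or-drop X (suc k)
    ... | inj₁ drop       = drop
    ... | inj₂ increasing = ⊥-elim (<-irrefl refl (<-≤-trans (increasing k ℕ.≤-refl) (stops-increasing k dominated increasing)))

-- X (k+1) is chosen so that c′ (X k - Y k) = X (k+1) + X 0, where Y k is the buyback cost paid so far.
module Recurrence (f c′ : ℚ) where

  pairs : ℕ → ℚ × ℚ
  pairs zero    = 1ℚ , 0ℚ
  pairs (suc k) = c′ * (proj₁ (pairs k) - proj₂ (pairs k)) - 1ℚ , proj₂ (pairs k) + f * proj₁ (pairs k)

  X Y : ℕ → ℚ
  X = proj₁ ∘ pairs
  Y = proj₂ ∘ pairs

  buybackTotal≡Y : ∀ k → buybackTotal f X k ≡ Y k
  buybackTotal≡Y zero    = refl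
  buybackTotal≡Y (suc k) = cong (_+ f * X k) (buybackTotal≡Y k)

  X-suc : ∀ k → X (suc k) + 1ℚ ≡ c′ * (X k - Y k)
  X-suc k = solve 3 (λ x y c → (c :* (x :- y) :- con 1ℚ) :+ con 1ℚ := c :* (x :- y)) refl (X k) (Y k) c′

  X-recurrence : ∀ k → X (suc (suc k)) ≡ (1ℚ + c′) * X (suc k) - c′ * (1ℚ + f) * X k
  X-recurrence k = solve 4 (λ x y c f →
      c :* ((c :* (x :- y) :- con 1ℚ) :- (y :+ f :* x)) :- con 1ℚ
        := (con 1ℚ :+ c) :* (c :* (x :- y) :- con 1ℚ) :- c :* (con 1ℚ :+ f) :* x)
    refl (X k) (Y k) c′ f

scaled-below : ∀ {c c′ d r} → 0ℚ ≤ c → c < c′ → c′ * d ≤ r → 0ℚ < r → c * d < r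
scaled-below {c} {c′} {d} 0≤c c<c′ c′d≤r 0<r with 0ℚ <? d
... | yes 0<d = <-≤-trans (*-monoˡ-<-pos d {{positive 0<d}} c<c′) c′d≤r
... | no  d≯0 = ≤-<-trans (≤-trans (*-monoˡ-≤-nonNeg c {{nonNegative 0≤c}} (≮⇒≥ d≯0)) (≤-reflexive (*-zeroʳ c))) 0<r

beatsRatio-below-two : ∀ f alg c → c < two → c * (1ℚ - f) < two → BeatsRatio f alg c
beatsRatio-below-two f alg c c<2 c[1-f]<2 =
  Adversary.beatsRatio f alg (λ _ → 1ℚ) c 0<1 0 (λ _ _ → <⇒≤ 0<1) deviation following
  where
  deviation : ∀ k → k ℕ.< 1 → c * (1ℚ - buybackTotal f (λ _ → 1ℚ) k) < 1ℚ + 1ℚ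
  deviation zero _ = subst₂ _<_ (solve 1 (λ c → c := c :* (con 1ℚ :- con 0ℚ)) refl c) refl c<2
  deviation (suc k) (ℕ.s≤s ())
  following : c * (1ℚ - (0ℚ + f * 1ℚ)) < 1ℚ + 1ℚ
  following = subst₂ _<_ (solve 2 (λ c f → c :* (con 1ℚ :- f) := c :* (con 1ℚ :- (con 0ℚ :+ f :* con 1ℚ))) refl c f)
                         refl c[1-f]<2

-- Growth only needs t₁ + t₂ = 1 + c′ and t₁ t₂ ≤ c′ (1 + f); ε = (2 - c (1 - f)) / 4 leaves slack
-- in every inequality, and f < 1/3 is what makes t₁ < t₂.
beatsRatio-from-two : ∀ f alg c → 0ℚ ≤ f → f < oneThird → two ≤ c → c * (1ℚ - f) < two → BeatsRatio f alg c
beatsRatio-from-two f alg c 0≤f f<⅓ 2≤c c[1-f]<2 = from-drop eventually-drops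
  where
  g ε c′ t₁ t₂ : ℚ
  g  = two - c * (1ℚ - f)
  ε  = g * (ℤ.+ 1 / 4)
  c′ = c + ε
  t₁ = c - 1ℚ + (ε + ε)
  t₂ = two - ε

  0<g : 0ℚ < g
  0<g = p<q⇒0<q-p c[1-f]<2

  0<ε : 0ℚ < ε
  0<ε = *-pos 0<g (positive⁻¹ (ℤ.+ 1 / 4))

  0≤c : 0ℚ ≤ c
  0≤c = ≤-trans (<⇒≤ (positive⁻¹ two)) 2≤c

  c<c′ : c < c′
  c<c′ = <-byDifference ε (solve 2 (λ c e → (c :+ e) :- c := e) refl c ε) 0<ε

  open Recurrence f c′

  t₁+t₂ : 1ℚ + c′ ≡ t₁ + t₂
  t₁+t₂ = solve 2 (λ c e → con 1ℚ :+ (c :+ e) := (c :- con 1ℚ :+ (e :+ e)) :+ (con two :- e)) refl c ε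

  t₁t₂≤q : t₁ * t₂ ≤ c′ * (1ℚ + f)
  t₁t₂≤q = ≤-byDifference (ε * (c + f) + two * (ε * ε))
    (solve 2 (λ c f → let e = (con two :- c :* (con 1ℚ :- f)) :* con (ℤ.+ 1 / 4) in
                       (c :+ e) :* (con 1ℚ :+ f) :- (c :- con 1ℚ :+ (e :+ e)) :* (con two :- e)
                       := e :* (c :+ f) :+ con two :* (e :* e)) refl c f)
    (+-mono-≤ (*-nonNeg (<⇒≤ 0<ε) (+-mono-≤ 0≤c 0≤f))
              (*-nonNeg (<⇒≤ (positive⁻¹ two)) (*-nonNeg (<⇒≤ 0<ε) (<⇒≤ 0<ε))))

  1≤t₁ : 1ℚ ≤ t₁
  1≤t₁ = ≤-byDifference ((c - two) + (ε + ε))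
    (solve 2 (λ c e → (c :- con 1ℚ :+ (e :+ e)) :- con 1ℚ := (c :- con two) :+ (e :+ e)) refl c ε)
    (+-mono-≤ (p≤q⇒0≤q-p 2≤c) (+-mono-≤ (<⇒≤ 0<ε) (<⇒≤ 0<ε)))

  0<1-3f : 0ℚ < 1ℚ - ℤ.+ 3 / 1 * f
  0<1-3f = subst (0ℚ <_) (solve 1 (λ f → con (ℤ.+ 3 / 1) :* (con oneThird :- f) := con 1ℚ :- con (ℤ.+ 3 / 1) :* f) refl f)
                 (*-pos (positive⁻¹ (ℤ.+ 3 / 1)) (p<q⇒0<q-p f<⅓))

  t₁<t₂ : t₁ < t₂
  t₁<t₂ = <-byDifference (g * (ℤ.+ 3 / 4) + c * (1ℚ - ℤ.+ 3 / 1 * f) * (ℤ.+ 1 / 2))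
    (solve 2 (λ c f → let e = (con two :- c :* (con 1ℚ :- f)) :* con (ℤ.+ 1 / 4) in
                       (con two :- e) :- (c :- con 1ℚ :+ (e :+ e))
                       := (con two :- c :* (con 1ℚ :- f)) :* con (ℤ.+ 3 / 4)
                          :+ c :* (con 1ℚ :- con (ℤ.+ 3 / 1) :* f) :* con (ℤ.+ 1 / 2)) refl c f)
    (+-mono-<-≤ (*-pos 0<g (positive⁻¹ (ℤ.+ 3 / 4)))
                (*-nonNeg (*-nonNeg 0≤c (<⇒≤ 0<1-3f)) (<⇒≤ (positive⁻¹ (ℤ.+ 1 / 2)))))

  X₁<t₁X₀ : X 1 < t₁ * X 0
  X₁<t₁X₀ = <-byDifference ε
    (solve 2 (λ c e → (c :- con 1ℚ :+ (e :+ e)) :* con 1ℚ :- ((c :+ e) :* (con 1ℚ :- con 0ℚ) :- con 1ℚ) := e) refl c ε)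
    0<ε

  X₀<X₁ : X 0 < X 1
  X₀<X₁ = <-byDifference ((c - two) + ε)
    (solve 2 (λ c e → ((c :+ e) :* (con 1ℚ :- con 0ℚ) :- con 1ℚ) :- con 1ℚ := (c :- con two) :+ e) refl c ε)
    (+-mono-≤-< (p≤q⇒0≤q-p 2≤c) 0<ε)

  open Growth X (c′ * (1ℚ + f)) t₁ t₂
    (λ k → subst (λ s → X (suc (suc k)) ≡ s * X (suc k) - c′ * (1ℚ + f) * X k) t₁+t₂ (X-recurrence k))
    t₁t₂≤q 1≤t₁ t₁<t₂ (<⇒≤ 0<1) X₁<t₁X₀
    using (increasing⇒nonNeg; eventually-drops)

  0<X+1 : ∀ k → 0ℚ ≤ X k → 0ℚ < X k + 1ℚ
  0<X+1 k 0≤X = +-mono-≤-< 0≤X 0<1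

  from-drop : (∃ λ N → Increasing X N × X (suc N) ≤ X N) → BeatsRatio f alg c
  from-drop (zero , _ , X₁≤X₀) = ⊥-elim (<-irrefl refl (<-≤-trans X₀<X₁ X₁≤X₀))
  from-drop (suc M , increasing , drop) =
    Adversary.beatsRatio f alg X c 0<1 M nonNeg deviation following
    where
    nonNeg : ∀ k → k ℕ.≤ suc M → 0ℚ ≤ X k
    nonNeg = increasing⇒nonNeg increasing
    deviation : ∀ k → k ℕ.< suc M → c * (X k - buybackTotal f X k) < X (suc k) + 1ℚ
    deviation k k<1+M = subst (λ y → c * (X k - y) < X (suc k) + 1ℚ) (sym (buybackTotal≡Y k))
      (scaled-below 0≤c c<c′ (≤-reflexive (sym (X-suc k))) (0<X+1 (suc k) (nonNeg (suc k) k<1+M)))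
    following : c * (X (suc M) - buybackTotal f X (suc M)) < X (suc M) + 1ℚ
    following = subst (λ y → c * (X (suc M) - y) < X (suc M) + 1ℚ) (sym (buybackTotal≡Y (suc M)))
      (scaled-below 0≤c c<c′ (≤-trans (≤-reflexive (sym (X-suc (suc M)))) (+-monoˡ-≤ 1ℚ drop))
                    (0<X+1 (suc M) (nonNeg (suc M) ℕ.≤-refl)))

mainTheorem9 : (f : ℚ) → 0ℚ ≤ f → f < oneThird →
    (alg : Algorithm 2) →
    (c : ℚ) → 0ℚ ≤ c → c * (1ℚ - f) < two →
    ∃ λ (I : Instance 2) → ValidInstance I ×
      ∃ λ (M : Matching I) → c * profit f alg I < matchWeight I M
mainTheorem9 f 0≤f f<⅓ alg c _ c[1-f]<2 with c <? two
... | yes c<2 = beatsRatio-below-two f alg c c<2 c[1-f]<2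
... | no  c≮2 = beatsRatio-from-two f alg c 0≤f f<⅓ (≮⇒≥ c≮2) c[1-f]<2
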